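{- Let $T$ be a tree of order $n$ such that $d(T)$ equals the second-largest value of $d$ among all trees of order $n$. Let $u_q$ be a quasi-pendant vertex of $T$, and suppose $u_q$ is adjacent to exactly $s$ pendant vertices. Then $s\le 3$.
   Context: All graphs are finite, simple and undirected. A subset $S$ of vertices of a graph $G$ is a dissociation set if the subgraph induced by $S$ has maximum degree at most one (the empty set is a dissociation set). $d(G)$ denotes the total number of dissociation sets of $G$ (including the empty set). A pendant vertex is a vertex of degree one; a quasi-pendant vertex is a vertex of degree at least two that is adjacent to a pendant vertex. -}

module Defs where

open import Data.Bool using (Bool; true; false; if_then_else_; _∧_; not; T)
open import Data.Nat using (ℕ; zero; suc; _≤_; _<_; _≤ᵇ_)
open import Data.Fin using (Fin)
open import Data.List using (List; []; _∷_; length; filter; allFin; map; _++_)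
open import Data.List.Relation.Unary.Unique.Propositional using (Unique)
open import Data.List.Relation.Unary.All using (All)
open import Data.Vec using (Vec; lookup)
import Data.Vec as Vec
open import Data.Product using (Σ; _×_; ∃)
open import Data.Empty using (⊥)
open import Relation.Nullary using (¬_)
open import Relation.Nullary.Decidable using (T?)
open import Relation.Binary.PropositionalEquality using (_≡_)

record Graph (n : ℕ) : Set where
  field
    adj    : Fin n → Fin n → Bool
    sym    : ∀ i j → adj i j ≡ adj j i
    irrefl : ∀ i → adj i i ≡ false
open Graph public

_~[_]_ : ∀ {n} → Fin n → Graph n → Fin n → Set
i ~[ G ] j = T (adj G i j)

deg : ∀ {n} → Graph n → Fin n → ℕ
deg G i = length (filter (λ j → T? (adj G i j)) (allFin _))

data Reach {n : ℕ} (G : Graph n) : Fin n → Fin n → Set where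
  here : ∀ {i} → Reach G i i
  step : ∀ {i j k} → i ~[ G ] j → Reach G j k → Reach G i k

Connected : ∀ {n} → Graph n → Set
Connected G = ∀ i j → Reach G i j

PathAdj : ∀ {n} → Graph n → List (Fin n) → Set
PathAdj G []           = Data.Unit.⊤ where import Data.Unit
PathAdj G (x ∷ [])     = Data.Unit.⊤ where import Data.Unit
PathAdj G (x ∷ y ∷ xs) = x ~[ G ] y × PathAdj G (y ∷ xs)

lastOf : ∀ {A : Set} → A → List A → A
lastOf a []       = a
lastOf a (x ∷ xs) = lastOf x xs

Cycle : ∀ {n} → Graph n → List (Fin n) → Set
Cycle G []       = ⊥
Cycle G (v ∷ vs) =
  3 ≤ length (v ∷ vs) × Unique (v ∷ vs) × PathAdj G (v ∷ vs) × lastOf v vs ~[ G ] v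

Acyclic : ∀ {n} → Graph n → Set
Acyclic G = ∀ c → ¬ Cycle G c

IsTree : ∀ {n} → Graph n → Set
IsTree {n} G = 1 ≤ n × Connected G × Acyclic G

subsets : (n : ℕ) → List (Vec Bool n)
subsets zero    = Vec.[] ∷ []
subsets (suc n) = map (true Vec.∷_) (subsets n) ++ map (false Vec.∷_) (subsets n)

degIn : ∀ {n} → Graph n → Vec Bool n → Fin n → ℕ
degIn G S i = length (filter (λ j → T? (lookup S j ∧ adj G i j)) (allFin _))

allᵇ : ∀ {A : Set} → (A → Bool) → List A → Bool
allᵇ p []       = true
allᵇ p (x ∷ xs) = p x ∧ allᵇ p xs

isDissociationᵇ : ∀ {n} → Graph n → Vec Bool n → Bool
isDissociationᵇ G S =
  allᵇ (λ i → not (lookup S i) Data.Bool.∨ (degIn G S i ≤ᵇ 1)) (allFin _)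
  where import Data.Bool

-- d(G): the number of dissociation sets (including ∅).
d : ∀ {n} → Graph n → ℕ
d G = length (filter (λ S → T? (isDissociationᵇ G S)) (subsets _))

-- v is the second-largest value of d among all trees of order n:
-- v is attained by a tree, some tree has a larger value, and all trees
-- with value larger than v share a single value.
IsSecondLargestD : ℕ → ℕ → Set
IsSecondLargestD n v =
  (Σ (Graph n) λ T₀ → IsTree T₀ × d T₀ ≡ v)
  × (Σ (Graph n) λ T₁ → IsTree T₁ × v < d T₁)
  × (∀ (T₁ T₂ : Graph n) → IsTree T₁ → IsTree T₂ → v < d T₁ → v < d T₂ → d T₁ ≡ d T₂)

Pendant : ∀ {n} → Graph n → Fin n → Set
Pendant G v = deg G v ≡ 1

QuasiPendant : ∀ {n} → Graph n → Fin n → Set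
QuasiPendant G u = 2 ≤ deg G u × ∃ λ v → u ~[ G ] v × Pendant G v

pendantNeighbours : ∀ {n} → Graph n → Fin n → ℕ
pendantNeighbours G u =
  length (filter (λ v → T? (adj G u v ∧ (deg G v Data.Nat.≡ᵇ 1))) (allFin _))
  where import Data.Nat

-- If u had four pendant neighbours l₁ … l₄, re-hanging l₂ from l₁ (delete l₂u,
-- add l₂l₁) gives another tree in which every dissociation set of T survives and
-- {u, l₂, l₃} is a new one, so d strictly increases.  In the new tree l₃, l₄ are
-- still pendant at u and l₁ is still adjacent to u, so re-hanging l₄ from l₃
-- increases d once more.  This gives two trees whose values of d are different and
-- both exceed d(T), whereas only one value of d lies above the second-largest.
module Submission where

open import Data.Bool using (Bool; true; false; _∧_; _∨_; not; T)
open import Data.Bool.Properties using (T-∧)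
open import Data.Empty using (⊥-elim)
open import Data.Fin using (Fin; _≟_)
open import Data.List using (List; []; _∷_; [_]; length; filterᵇ; allFin; map; _++_)
open import Data.List.Membership.Propositional using (_∈_; _∉_)
open import Data.List.Membership.Propositional.Properties
  using (∈-allFin; ∈-map⁺; ∈-++⁺ˡ; ∈-++⁺ʳ; ∈-∃++)
open import Data.List.Properties using (length-++; filter-none; ++-assoc)
open import Data.List.Relation.Unary.Any using (here; there)
open import Data.List.Relation.Unary.All as All using (All; []; _∷_)
open import Data.List.Relation.Unary.All.Properties using (all-filter; ¬Any⇒All¬; ++⁺)
open import Data.List.Relation.Unary.AllPairs using ([]; _∷_)
open import Data.List.Relation.Unary.Unique.Propositional using (Unique)
open import Data.List.Relation.Unary.Unique.Propositional.Properties using (allFin⁺; filter⁺)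
open import Data.Nat using (ℕ; suc; _≤_; _<_; z≤n; s≤s; _≡ᵇ_)
open import Data.Nat.Properties
  using (≤-reflexive; ≤-trans; <-trans; <-irrefl; m≤n⇒m≤1+n; ≤ᵇ⇒≤; ≤⇒≤ᵇ; ≡ᵇ⇒≡; +-comm)
open import Data.Product using (∃; _×_; _,_; proj₁; proj₂)
open import Data.Sum using (_⊎_; inj₁; inj₂)
import Data.Sum as Sum
open import Data.Vec using (Vec; lookup; tabulate)
import Data.Vec as Vec
open import Data.Vec.Properties using (lookup∘tabulate)
open import Function using (id; _∘_)
open import Function.Bundles using (Equivalence; mk⇔)
open import Relation.Nullary using (¬_; Dec; yes; no)
open import Relation.Nullary.Decidable
  using (T?; ⌊_⌋; toWitness; fromWitness; isYes≗does; does-⇔; dec-false; ¬?; _×-dec_; _⊎-dec_)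
open import Relation.Binary.PropositionalEquality
  using (_≡_; _≢_; refl; sym; trans; cong; subst; ≢-sym)

open import Defs hiding (sym)

countᵇ : {A : Set} → (A → Bool) → List A → ℕ
countᵇ f xs = length (filterᵇ f xs)

module _ {A : Set} {f g : A → Bool} where

  countᵇ-mono : (∀ {x} → T (f x) → T (g x)) → ∀ xs → countᵇ f xs ≤ countᵇ g xs
  countᵇ-mono f⇒g []       = z≤n
  countᵇ-mono f⇒g (x ∷ xs) with f x | g x | f⇒g {x}
  ... | true  | true  | _   = s≤s (countᵇ-mono f⇒g xs)
  ... | true  | false | f⇒g = ⊥-elim (f⇒g _)
  ... | false | true  | _   = m≤n⇒m≤1+n (countᵇ-mono f⇒g xs)
  ... | false | false | _   = countᵇ-mono f⇒g xs

  countᵇ-< : (∀ {x} → T (f x) → T (g x)) → ∀ {x} xs → x ∈ xs → T (g x) → ¬ T (f x) →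
             countᵇ f xs < countᵇ g xs
  countᵇ-< f⇒g {x} (x ∷ xs) (here refl) gx ¬fx with f x | g x
  ... | true  | _     = ⊥-elim (¬fx _)
  ... | false | true  = s≤s (countᵇ-mono f⇒g xs)
  countᵇ-< f⇒g (y ∷ xs) (there x∈xs) gx ¬fx with f y | g y | f⇒g {y}
  ... | true  | true  | _   = s≤s (countᵇ-< f⇒g xs x∈xs gx ¬fx)
  ... | true  | false | f⇒g = ⊥-elim (f⇒g _)
  ... | false | true  | _   = m≤n⇒m≤1+n (countᵇ-< f⇒g xs x∈xs gx ¬fx)
  ... | false | false | _   = countᵇ-< f⇒g xs x∈xs gx ¬fx

module _ {A : Set} {f : A → Bool} where

  countᵇ-≤1 : ∀ {a xs} → Unique xs → (∀ {x} → T (f x) → x ≡ a) → countᵇ f xs ≤ 1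
  countᵇ-≤1 {xs = []}     _              _    = z≤n
  countᵇ-≤1 {xs = x ∷ xs} (x∉xs ∷ uniq) only with f x | only {x}
  ... | false | _      = countᵇ-≤1 uniq only
  ... | true  | x≡a    = s≤s (≤-reflexive (cong length (filter-none (T? ∘ f) (All.map ¬f x∉xs))))
    where
    ¬f : ∀ {y} → x ≢ y → ¬ T (f y)
    ¬f x≢y fy = x≢y (trans (x≡a _) (sym (only fy)))

  countᵇ-≥1 : ∀ {x} xs → x ∈ xs → T (f x) → 1 ≤ countᵇ f xs
  countᵇ-≥1 xs x∈xs fx = ≤-trans (s≤s z≤n) (countᵇ-< {f = λ _ → false} (λ ()) xs x∈xs fx id)

  countᵇ-≥2 : ∀ {x y} xs → x ≢ y → x ∈ xs → y ∈ xs → T (f x) → T (f y) → 2 ≤ countᵇ f xs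
  countᵇ-≥2 (z ∷ xs) x≢y (here refl) (here refl) _ _ = ⊥-elim (x≢y refl)
  countᵇ-≥2 (z ∷ xs) x≢y (here refl) (there y∈xs) fx fy with f z
  ... | true = s≤s (countᵇ-≥1 xs y∈xs fy)
  countᵇ-≥2 (z ∷ xs) x≢y (there x∈xs) (here refl) fx fy with f z
  ... | true = s≤s (countᵇ-≥1 xs x∈xs fx)
  countᵇ-≥2 (z ∷ xs) x≢y (there x∈xs) (there y∈xs) fx fy with f z
  ... | true  = m≤n⇒m≤1+n (countᵇ-≥2 xs x≢y x∈xs y∈xs fx fy)
  ... | false = countᵇ-≥2 xs x≢y x∈xs y∈xs fx fy

module _ {n : ℕ} (G : Graph n) where

  ~-sym : ∀ {i j} → i ~[ G ] j → j ~[ G ] i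
  ~-sym {i} {j} = subst T (Graph.sym G i j)

  ~-irrefl : ∀ {i j} → i ~[ G ] j → i ≢ j
  ~-irrefl {i} i~i refl = subst T (irrefl G i) i~i

  PendantAt : Fin n → Fin n → Set
  PendantAt u b = u ~[ G ] b × (∀ {j} → b ~[ G ] j → j ≡ u)

  pendant-neighbour-unique : ∀ {v x y} → Pendant G v → v ~[ G ] x → v ~[ G ] y → x ≡ y
  pendant-neighbour-unique {v} {x} {y} deg≡1 v~x v~y with x ≟ y
  ... | yes x≡y = x≡y
  ... | no x≢y  = ⊥-elim (<-irrefl refl (subst (2 ≤_) deg≡1
                    (countᵇ-≥2 (allFin n) x≢y (∈-allFin x) (∈-allFin y) v~x v~y)))

  pendant⇒PendantAt : ∀ {u v} → u ~[ G ] v → Pendant G v → PendantAt u v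
  pendant⇒PendantAt u~v deg≡1 = u~v , λ v~j → pendant-neighbour-unique deg≡1 v~j (~-sym u~v)

lastOf-∷ʳ : ∀ {A : Set} (w : A) ws v → lastOf w (ws ++ [ v ]) ≡ v
lastOf-∷ʳ w []       v = refl
lastOf-∷ʳ w (y ∷ ys) v = lastOf-∷ʳ y ys v

lastOf-∈ : ∀ {A : Set} (w : A) ws → lastOf w ws ∈ w ∷ ws
lastOf-∈ w []       = here refl
lastOf-∈ w (y ∷ ys) = there (lastOf-∈ y ys)

Unique-rotate : ∀ {A : Set} {v : A} {xs} → Unique (v ∷ xs) → Unique (xs ++ [ v ])
Unique-rotate {xs = []}     _                            = [] ∷ []
Unique-rotate {xs = x ∷ xs} ((v≢x ∷ v∉xs) ∷ x∉xs ∷ uniq) =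
  ++⁺ x∉xs (≢-sym v≢x ∷ []) ∷ Unique-rotate (v∉xs ∷ uniq)

module _ {n : ℕ} {G : Graph n} where

  PathAdj-∷ʳ : ∀ {x v} xs → PathAdj G (x ∷ xs) → lastOf x xs ~[ G ] v → PathAdj G (x ∷ xs ++ [ v ])
  PathAdj-∷ʳ []       _          x~v = x~v , _
  PathAdj-∷ʳ (y ∷ ys) (x~y , py) y~v = x~y , PathAdj-∷ʳ ys py y~v

  cycle-rotate : ∀ {v w} ws → Cycle G (v ∷ w ∷ ws) → Cycle G (w ∷ ws ++ [ v ])
  cycle-rotate {v} {w} ws (3≤len , uniq , (v~w , path) , last~v) =
    subst (λ k → 3 ≤ suc k) (trans (+-comm 1 (length ws)) (sym (length-++ ws))) 3≤len ,
    Unique-rotate uniq ,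
    PathAdj-∷ʳ ws path last~v ,
    subst (λ z → z ~[ G ] w) (sym (lastOf-∷ʳ w ws v)) v~w

  cycle-rotate-to : ∀ {v x post} pre → Cycle G (v ∷ pre ++ x ∷ post) → ∃ λ ws → Cycle G (x ∷ ws)
  cycle-rotate-to             []        cycle = _ , cycle-rotate _ cycle
  cycle-rotate-to {v} {x} {post} (p ∷ pre) cycle =
    cycle-rotate-to pre (subst (λ l → Cycle G (p ∷ l)) (++-assoc pre (x ∷ post) [ v ])
                                (cycle-rotate (pre ++ x ∷ post) cycle))

  cycle-through : ∀ {x} c → x ∈ c → Cycle G c → ∃ λ ws → Cycle G (x ∷ ws)
  cycle-through (v ∷ vs) (here refl) cycle = vs , cycle
  cycle-through (v ∷ vs) (there x∈vs) cycle with ∈-∃++ x∈vs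
  ... | pre , post , refl = cycle-rotate-to pre cycle

  -- the two cycle-neighbours of the head are its successor and the last vertex
  leaf-not-head : ∀ {x a} → (∀ {j} → x ~[ G ] j → j ≡ a) → ∀ ws → ¬ Cycle G (x ∷ ws)
  leaf-not-head leaf (w ∷ w₂ ∷ ws) (_ , (_ ∷ (w∉ws ∷ _)) , (x~w , _) , last~x) =
    All.lookup w∉ws (lastOf-∈ w₂ ws) (trans (leaf x~w) (sym (leaf (~-sym G last~x))))
  leaf-not-head leaf []          (s≤s () , _)
  leaf-not-head leaf (_ ∷ [])    (s≤s (s≤s ()) , _)

  leaf-∉-cycle : ∀ {x a c} → (∀ {j} → x ~[ G ] j → j ≡ a) → Cycle G c → x ∉ c
  leaf-∉-cycle leaf cycle x∈c = leaf-not-head leaf _ (proj₂ (cycle-through _ x∈c cycle))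

module _ {n : ℕ} {G H : Graph n} {P : Fin n → Set}
         (H⇒G : ∀ {i j} → P i → P j → i ~[ H ] j → i ~[ G ] j) where

  PathAdj-transfer : ∀ xs → All P xs → PathAdj H xs → PathAdj G xs
  PathAdj-transfer []           _                    _           = _
  PathAdj-transfer (x ∷ [])     _                    _           = _
  PathAdj-transfer (x ∷ y ∷ xs) (px ∷ all@(py ∷ _)) (x~y , path) =
    H⇒G px py x~y , PathAdj-transfer (y ∷ xs) all path

  cycle-transfer : ∀ c → All P c → Cycle H c → Cycle G c
  cycle-transfer (v ∷ vs) all (len , uniq , path , last~v) =
    len , uniq , PathAdj-transfer (v ∷ vs) all path ,
    H⇒G (All.lookup all (lastOf-∈ v vs)) (All.head all) last~v

module _ {n : ℕ} where

  open import Data.List.Membership.DecPropositional (_≟_ {n}) using (_∈?_)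

  Joins : Fin n → Fin n → Fin n → Fin n → Set
  Joins x y i j = (i ≡ x × j ≡ y) ⊎ (i ≡ y × j ≡ x)

  joins? : ∀ x y i j → Dec (Joins x y i j)
  joins? x y i j = (i ≟ x ×-dec j ≟ y) ⊎-dec (i ≟ y ×-dec j ≟ x)

  Joins-swap : ∀ {x y i j} → Joins x y i j → Joins x y j i
  Joins-swap (inj₁ (i≡x , j≡y)) = inj₂ (j≡y , i≡x)
  Joins-swap (inj₂ (i≡y , j≡x)) = inj₁ (j≡x , i≡y)

  Joins-irrefl : ∀ {x y i} → x ≢ y → ¬ Joins x y i i
  Joins-irrefl x≢y (inj₁ (refl , refl)) = x≢y refl
  Joins-irrefl x≢y (inj₂ (refl , refl)) = x≢y refl

  ¬Joins : ∀ {x y i j} → i ≢ x → i ≢ y → ¬ Joins x y i j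
  ¬Joins i≢x i≢y (inj₁ (i≡x , _)) = i≢x i≡x
  ¬Joins i≢x i≢y (inj₂ (i≡y , _)) = i≢y i≡y

  graphFromDec : (R : Fin n → Fin n → Set) → (∀ i j → Dec (R i j)) →
                 (∀ {i j} → R i j → R j i) → (∀ {i} → ¬ R i i) → Graph n
  graphFromDec R R? R-sym R-irrefl = record
    { adj    = λ i j → ⌊ R? i j ⌋
    ; sym    = λ i j → trans (isYes≗does (R? i j))
                         (trans (does-⇔ (mk⇔ R-sym R-sym) (R? i j) (R? j i)) (sym (isYes≗does (R? j i))))
    ; irrefl = λ i → trans (isYes≗does (R? i i)) (dec-false (R? i i) R-irrefl)
    }

  characteristic : List (Fin n) → Vec Bool n
  characteristic xs = tabulate (λ j → ⌊ j ∈? xs ⌋)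

  characteristic-∈ : ∀ xs {j} → T (lookup (characteristic xs) j) → j ∈ xs
  characteristic-∈ xs {j} t =
    toWitness (subst T (lookup∘tabulate (λ j → ⌊ j ∈? xs ⌋) j) t)

  ∈-characteristic : ∀ xs {j} → j ∈ xs → T (lookup (characteristic xs) j)
  ∈-characteristic xs {j} j∈xs =
    subst T (sym (lookup∘tabulate (λ j → ⌊ j ∈? xs ⌋) j)) (fromWitness j∈xs)

module _ {A : Set} {p : A → Bool} where

  allᵇ⇒All : ∀ xs → T (allᵇ p xs) → All (T ∘ p) xs
  allᵇ⇒All []       _ = []
  allᵇ⇒All (x ∷ xs) t = let px , pxs = Equivalence.to T-∧ t in px ∷ allᵇ⇒All xs pxs

  All⇒allᵇ : ∀ {xs} → All (T ∘ p) xs → T (allᵇ p xs)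
  All⇒allᵇ []         = _
  All⇒allᵇ (px ∷ pxs) = Equivalence.from T-∧ (px , All⇒allᵇ pxs)

T-not-∨⇒ : ∀ {x y} → T (not x ∨ y) → T x → T y
T-not-∨⇒ {true} y _ = y

⇒T-not-∨ : ∀ {x y} → (T x → T y) → T (not x ∨ y)
⇒T-not-∨ {true}  x⇒y = x⇒y _
⇒T-not-∨ {false} _   = _

∈-subsets : ∀ {n} (S : Vec Bool n) → S ∈ subsets n
∈-subsets Vec.[]                    = here refl
∈-subsets (true  Vec.∷ S)           = ∈-++⁺ˡ (∈-map⁺ (true Vec.∷_) (∈-subsets S))
∈-subsets {suc n} (false Vec.∷ S) = ∈-++⁺ʳ (map (true Vec.∷_) (subsets n)) (∈-map⁺ (false Vec.∷_) (∈-subsets S))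

module _ {n : ℕ} where

  Dissociation : Graph n → Vec Bool n → Set
  Dissociation G S = ∀ i → T (lookup S i) → degIn G S i ≤ 1

  isDissociationᵇ⇒ : ∀ G S → T (isDissociationᵇ G S) → Dissociation G S
  isDissociationᵇ⇒ G S t i i∈S =
    ≤ᵇ⇒≤ (degIn G S i) 1 (T-not-∨⇒ (All.lookup (allᵇ⇒All (allFin n) t) (∈-allFin i)) i∈S)

  ⇒isDissociationᵇ : ∀ G S → Dissociation G S → T (isDissociationᵇ G S)
  ⇒isDissociationᵇ G S dis = All⇒allᵇ {xs = allFin n} (All.tabulate λ {i} _ → ⇒T-not-∨ (≤⇒≤ᵇ ∘ dis i))

  d-strictMono : ∀ G H → (∀ S → Dissociation G S → Dissociation H S) →
                 ∀ S → Dissociation H S → ¬ Dissociation G S → d G < d H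
  d-strictMono G H G⇒H S disH ¬disG =
    countᵇ-< (λ {S′} → ⇒isDissociationᵇ H S′ ∘ G⇒H S′ ∘ isDissociationᵇ⇒ G S′) (subsets n)
             (∈-subsets S) (⇒isDissociationᵇ H S disH) (¬disG ∘ isDissociationᵇ⇒ G S)

  module _ (G : Graph n) (S : Vec Bool n) {i : Fin n} where

    degIn-≤1 : ∀ {a} → (∀ {j} → T (lookup S j) → i ~[ G ] j → j ≡ a) → degIn G S i ≤ 1
    degIn-≤1 only = countᵇ-≤1 (allFin⁺ n) λ t → let j∈S , i~j = Equivalence.to T-∧ t in only j∈S i~j

    degIn-≥2 : ∀ {j k} → j ≢ k → T (lookup S j) → T (lookup S k) → i ~[ G ] j → i ~[ G ] k →
               2 ≤ degIn G S i
    degIn-≥2 j≢k j∈S k∈S i~j i~k =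
      countᵇ-≥2 (allFin n) j≢k (∈-allFin _) (∈-allFin _)
        (Equivalence.from T-∧ (j∈S , i~j)) (Equivalence.from T-∧ (k∈S , i~k))

    degIn-mono : ∀ H {i′} → (∀ {j} → i ~[ G ] j → i′ ~[ H ] j) → degIn G S i ≤ degIn H S i′
    degIn-mono H G⇒H = countᵇ-mono (λ t → let j∈S , i~j = Equivalence.to T-∧ t in
                                          Equivalence.from T-∧ (j∈S , G⇒H i~j)) (allFin n)

-- Delete the edge ub and add ab: the leaves a, b of u become the pendant path u–a–b.
module Rehang {n : ℕ} (G : Graph n) {u a b : Fin n}
               (a≢b : a ≢ b) (pa : PendantAt G u a) (pb : PendantAt G u b) where

  open import Data.List.Membership.DecPropositional (_≟_ {n}) using (_∈?_)

  Adj : Fin n → Fin n → Set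
  Adj i j = (i ~[ G ] j × ¬ Joins u b i j) ⊎ Joins a b i j

  graph : Graph n
  graph = graphFromDec Adj (λ i j → (T? (adj G i j) ×-dec ¬? (joins? u b i j)) ⊎-dec joins? a b i j)
            (λ where (inj₁ (i~j , ¬J)) → inj₁ (~-sym G i~j , ¬J ∘ Joins-swap)
                     (inj₂ J)          → inj₂ (Joins-swap J))
            (λ where (inj₁ (i~i , _)) → ~-irrefl G i~i refl
                     (inj₂ J)         → Joins-irrefl a≢b J)

  _~′_ : Fin n → Fin n → Set
  i ~′ j = i ~[ graph ] j

  u≢a : u ≢ a
  u≢a = ~-irrefl G (proj₁ pa)

  u≢b : u ≢ b
  u≢b = ~-irrefl G (proj₁ pb)

  ~⇒~′ : ∀ {i j} → ¬ Joins u b i j → i ~[ G ] j → i ~′ j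
  ~⇒~′ ¬J i~j = fromWitness (inj₁ (i~j , ¬J))

  ~′⇒~ : ∀ {i j} → ¬ Joins a b i j → i ~′ j → i ~[ G ] j
  ~′⇒~ ¬J i~′j with toWitness i~′j
  ... | inj₁ (i~j , _) = i~j
  ... | inj₂ J         = ⊥-elim (¬J J)

  ¬u~′b : ¬ u ~′ b
  ¬u~′b u~′b with toWitness u~′b
  ... | inj₁ (_ , ¬J)          = ¬J (inj₁ (refl , refl))
  ... | inj₂ (inj₁ (u≡a , _)) = u≢a u≡a
  ... | inj₂ (inj₂ (u≡b , _)) = u≢b u≡b

  u~′ : ∀ {x} → x ≢ b → u ~[ G ] x → u ~′ x
  u~′ x≢b u~x = ~⇒~′ (¬Joins (≢-sym (~-irrefl G u~x)) x≢b ∘ Joins-swap) u~x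

  a~′b : a ~′ b
  a~′b = fromWitness (inj₂ (inj₁ (refl , refl)))

  b-neighbour : ∀ {j} → b ~′ j → j ≡ a
  b-neighbour b~′j with toWitness b~′j
  ... | inj₁ (b~j , ¬J)        = ⊥-elim (¬J (inj₂ (refl , proj₂ pb b~j)))
  ... | inj₂ (inj₁ (b≡a , _)) = ⊥-elim (a≢b (sym b≡a))
  ... | inj₂ (inj₂ (_ , j≡a)) = j≡a

  a-neighbours : ∀ {j} → a ~′ j → j ≡ u ⊎ j ≡ b
  a-neighbours a~′j with toWitness a~′j
  ... | inj₁ (a~j , _)          = inj₁ (proj₂ pa a~j)
  ... | inj₂ (inj₁ (_ , j≡b))   = inj₂ j≡b
  ... | inj₂ (inj₂ (a≡b , _))   = ⊥-elim (a≢b a≡b)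

  pendantAt-preserved : ∀ {x} → x ≢ a → x ≢ b → PendantAt G u x → PendantAt graph u x
  pendantAt-preserved x≢a x≢b (u~x , leaf) = u~′ x≢b u~x , leaf ∘ ~′⇒~ (¬Joins x≢a x≢b)

  walk : ∀ {i j} → Reach G i j → Reach graph i j
  walk here = here
  walk (step {i} {j} i~j r) with joins? u b i j
  ... | no ¬J                    = step (~⇒~′ ¬J i~j) (walk r)
  ... | yes (inj₁ (refl , refl)) = step (u~′ a≢b (proj₁ pa)) (step a~′b (walk r))
  ... | yes (inj₂ (refl , refl)) =
    step (~-sym graph a~′b) (step (~-sym graph (u~′ a≢b (proj₁ pa))) (walk r))

  acyclic : Acyclic G → Acyclic graph
  acyclic acyclicG c cycle with b ∈? c
  ... | yes b∈c = leaf-∉-cycle b-neighbour cycle b∈c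
  ... | no  b∉c =
    acyclicG c (cycle-transfer (λ b≢i b≢j → ~′⇒~ (¬Joins′ b≢i b≢j)) c (¬Any⇒All¬ c b∉c) cycle)
    where
    ¬Joins′ : ∀ {i j} → b ≢ i → b ≢ j → ¬ Joins a b i j
    ¬Joins′ b≢i b≢j (inj₁ (_ , j≡b)) = b≢j (sym j≡b)
    ¬Joins′ b≢i b≢j (inj₂ (i≡b , _)) = b≢i (sym i≡b)

  isTree : IsTree G → IsTree graph
  isTree (n≥1 , connected , acyclicG) = n≥1 , (λ i j → walk (connected i j)) , acyclic acyclicG

  dissociation-preserved : ∀ S → Dissociation G S → Dissociation graph S
  dissociation-preserved S dis i = by-cases (i ≟ b) (i ≟ a)
    where
    a-case : T (lookup S a) → Dec (T (lookup S u)) → Dec (T (lookup S b)) → degIn graph S a ≤ 1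
    a-case a∈S (yes u∈S) (yes b∈S) = ⊥-elim (<-irrefl refl (≤-trans
      (degIn-≥2 G S a≢b a∈S b∈S (proj₁ pa) (proj₁ pb)) (dis u u∈S)))
    a-case _   (no u∉S)  _         = degIn-≤1 graph S λ j∈S a~′j →
      Sum.[ (λ { refl → ⊥-elim (u∉S j∈S) }) , id ] (a-neighbours a~′j)
    a-case _   (yes _)   (no b∉S)  = degIn-≤1 graph S λ j∈S a~′j →
      Sum.[ id , (λ { refl → ⊥-elim (b∉S j∈S) }) ] (a-neighbours a~′j)

    by-cases : ∀ {i} → Dec (i ≡ b) → Dec (i ≡ a) → T (lookup S i) → degIn graph S i ≤ 1
    by-cases (yes refl) _          _   = degIn-≤1 graph S (λ _ → b-neighbour)
    by-cases (no i≢b)   (no i≢a)   i∈S = ≤-trans (degIn-mono graph S G (~′⇒~ (¬Joins i≢a i≢b))) (dis _ i∈S)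
    by-cases (no _)     (yes refl) a∈S = a-case a∈S (T? (lookup S u)) (T? (lookup S b))

  module _ {c : Fin n} (u~c : u ~[ G ] c) (c≢a : c ≢ a) (c≢b : c ≢ b) where

    W₀ : List (Fin n)
    W₀ = u ∷ b ∷ c ∷ []

    S₀ : Vec Bool n
    S₀ = characteristic W₀

    new-dissociation : Dissociation graph S₀
    new-dissociation i i∈S₀ with characteristic-∈ W₀ i∈S₀
    ... | here refl                 = degIn-≤1 graph S₀ λ j∈S₀ → u-neighbour (characteristic-∈ W₀ j∈S₀)
      where
      u-neighbour : ∀ {j} → j ∈ W₀ → u ~′ j → j ≡ c
      u-neighbour (here refl)                 u~′u = ⊥-elim (~-irrefl graph u~′u refl)
      u-neighbour (there (here refl))         u~′b = ⊥-elim (¬u~′b u~′b)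
      u-neighbour (there (there (here refl))) _    = refl
    ... | there (here refl)         = degIn-≤1 graph S₀ (λ _ → b-neighbour)
    ... | there (there (here refl)) = degIn-≤1 graph S₀ λ j∈S₀ → c-neighbour (characteristic-∈ W₀ j∈S₀)
      where
      c-neighbour : ∀ {j} → j ∈ W₀ → c ~′ j → j ≡ u
      c-neighbour (here refl)                 _    = refl
      c-neighbour (there (here refl))         c~′b =
        ⊥-elim (~-irrefl G u~c (sym (proj₂ pb (~-sym G (~′⇒~ (¬Joins c≢a c≢b) c~′b)))))
      c-neighbour (there (there (here refl))) c~′c = ⊥-elim (~-irrefl graph c~′c refl)

    old-non-dissociation : ¬ Dissociation G S₀
    old-non-dissociation dis = <-irrefl refl (≤-trans
      (degIn-≥2 G S₀ (≢-sym c≢b) (∈-characteristic W₀ (there (here refl)))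
                (∈-characteristic W₀ (there (there (here refl)))) (proj₁ pb) u~c)
      (dis u (∈-characteristic W₀ (here refl))))

    d-increases : d G < d graph
    d-increases = d-strictMono G graph dissociation-preserved S₀ new-dissociation old-non-dissociation

at-most-three-pendants : ∀ {n} {G : Graph n} {u} → IsTree G → IsSecondLargestD n (d G) →
                         ∀ ls → Unique ls → All (PendantAt G u) ls → length ls ≤ 3
at-most-three-pendants _ _ []                    _ _ = z≤n
at-most-three-pendants _ _ (_ ∷ [])              _ _ = s≤s z≤n
at-most-three-pendants _ _ (_ ∷ _ ∷ [])          _ _ = s≤s (s≤s z≤n)
at-most-three-pendants _ _ (_ ∷ _ ∷ _ ∷ [])      _ _ = s≤s (s≤s (s≤s z≤n))
at-most-three-pendants {G = G} tree (_ , _ , above-unique) (l₁ ∷ l₂ ∷ l₃ ∷ l₄ ∷ _)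
  ((l₁≢l₂ ∷ l₁≢l₃ ∷ l₁≢l₄ ∷ _) ∷ (l₂≢l₃ ∷ l₂≢l₄ ∷ _) ∷ (l₃≢l₄ ∷ _) ∷ _) (p₁ ∷ p₂ ∷ p₃ ∷ p₄ ∷ _) =
  ⊥-elim (<-irrefl d₁≡d₂ d₁<d₂)
  where
  module R₁ = Rehang G l₁≢l₂ p₁ p₂
  module R₂ = Rehang R₁.graph l₃≢l₄ (R₁.pendantAt-preserved (≢-sym l₁≢l₃) (≢-sym l₂≢l₃) p₃)
                                      (R₁.pendantAt-preserved (≢-sym l₁≢l₄) (≢-sym l₂≢l₄) p₄)

  d<d₁ : d G < d R₁.graph
  d<d₁ = R₁.d-increases (proj₁ p₃) (≢-sym l₁≢l₃) (≢-sym l₂≢l₃)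

  d₁<d₂ : d R₁.graph < d R₂.graph
  d₁<d₂ = R₂.d-increases (R₁.u~′ l₁≢l₂ (proj₁ p₁)) l₁≢l₃ l₁≢l₄

  d₁≡d₂ : d R₁.graph ≡ d R₂.graph
  d₁≡d₂ = above-unique _ _ (R₁.isTree tree) (R₂.isTree (R₁.isTree tree)) d<d₁ (<-trans d<d₁ d₁<d₂)

corollary2p7 : (n : ℕ) (T : Graph n) → IsTree T → IsSecondLargestD n (d T)
  → (u : Fin n) → QuasiPendant T u → (s : ℕ) → pendantNeighbours T u ≡ s → s ≤ 3
corollary2p7 n G tree second u _ _ refl =
  at-most-three-pendants tree second _ (filter⁺ _ (allFin⁺ n)) (All.map pendant (all-filter _ (allFin n)))
  where
  pendant : ∀ {v} → T (adj G u v ∧ (deg G v ≡ᵇ 1)) → PendantAt G u v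
  pendant t = let u~v , deg≡1 = Equivalence.to T-∧ t in pendant⇒PendantAt G u~v (≡ᵇ⇒≡ _ 1 deg≡1)
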